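{- Every $\omega B$-regular language over the alphabet $\{a,b\}$ that contains a word with infinitely many occurrences of $b$ also contains a word of the form $a^{n_0}ba^{n_1}ba^{n_2}b\cdots$ with $(n_i)_{i\in\mathbb N}$ bounded (i.e., a word in $(a^Bb)^\omega$).
   Context: A word sequence over $\Sigma$ is a finite or infinite sequence $\vec u=\langle u_0,u_1,\dots\rangle$ of finite words. An infinite sequence of naturals is bounded if $\limsup<\infty$, strongly unbounded if $\liminf=+\infty$. For non-decreasing $g$, $g'(i)=g(i+1)-g(i)$ for $i+1<|g|$; bounded (resp. strongly unbounded) difference means $g'$ finite or bounded (resp. finite or strongly unbounded). $K\cdot L=\{\langle u_0v_0,u_1v_1,\dots\rangle:\vec u\in K,\vec v\in L,|\vec u|=|\vec v|\}$; mix $K+L$ = set of $\vec w$ with $|\vec w|=\max(|\vec u|,|\vec v|)$ and $w_i\in\{u_i\}\cup\{v_i\}$ for $i<|\vec w|$, some $\vec u\in K,\vec v\in L$ ($\{u_i\}=\emptyset$ if $i\ge|\vec u|$); $L^*=\{\langle u_0\cdots u_{g(0)-1},u_{g(0)}\cdots u_{g(1)-1},\dots\rangle:\vec u\in L,g$ non-decreasing, values $\le|\vec u|\}$; $L^B,L^S$ likewise with $g$ of bounded, resp. strongly unbounded, difference. $BS$-regular expressions $e::=\emptyset\mid\varepsilon\mid\bar\varepsilon\mid a\mid e\cdot e\mid e+e\mid e^*\mid e^B\mid e^S$ with $[\![\emptyset]\!]=\{\langle\rangle\}$, $[\![\bar\varepsilon]\!]$ = finite sequences of empty words, $[\![\varepsilon]\!]=[\![\bar\varepsilon]\!]\cup\{\langle\varepsilon,\varepsilon,\dots\rangle\}$,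 $[\![a]\!]$ = all finite/infinite sequences of the word $a$; $B$-regular = no $S$. $\langle u_0,u_1,\dots\rangle^\omega=u_0u_1\cdots$ (defined if infinitely many $u_i$ nonempty). An $\omega B$-regular expression is $\sum_{i=1}^n e_i\cdot f_i^\omega$ with $e_i$ ordinary regular expressions and $f_i$ $B$-regular expressions, denoting $\bigcup_i[\![e_i]\!]\cdot[\![f_i]\!]^\omega$; $\omega B$-regular languages are those so denoted. -}

module Defs where

open import Data.Nat using (ℕ; zero; suc; _+_; _∸_; _≤_; _<_; _⊔_)
open import Data.List using (List; []; _∷_; _++_; length; lookup; map; concat; applyUpTo; replicate; [_])
open import Data.Fin using (Fin; toℕ)
open import Data.Product using (Σ; ∃; ∃-syntax; _×_; _,_)
open import Data.Sum using (_⊎_)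
open import Data.Unit using (⊤)
open import Data.Empty using (⊥)
open import Data.List.Relation.Unary.Any using (Any)
open import Relation.Binary.PropositionalEquality using (_≡_; _≢_)

Word : Set → Set
Word A = List A

data ℕ∞ : Set where
  fin : ℕ → ℕ∞
  ∞   : ℕ∞

_<ℓ_ : ℕ → ℕ∞ → Set
i <ℓ fin n = i < n
i <ℓ ∞     = ⊤

_≤ℓ_ : ℕ → ℕ∞ → Set
m ≤ℓ fin n = m ≤ n
m ≤ℓ ∞     = ⊤

max∞ : ℕ∞ → ℕ∞ → ℕ∞
max∞ (fin m) (fin n) = fin (m ⊔ n)
max∞ (fin _) ∞       = ∞
max∞ ∞       _       = ∞

-- Word sequences: a length (finite or ω) and the entries; entries at
-- indices ≥ len are irrelevant (all definitions below only look at
-- indices < len).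

record WSeq (A : Set) : Set where
  constructor wseq
  field
    len : ℕ∞
    at  : ℕ → Word A
open WSeq public

segment : {A : Set} → (ℕ → Word A) → ℕ → ℕ → Word A
segment u m n = concat (map u (applyUpTo (λ k → m + k) (n ∸ m)))

-- start of the i-th block for the grouping function g (g(-1) = 0)
prev : (ℕ → ℕ) → ℕ → ℕ
prev g zero    = 0
prev g (suc i) = g i

Grouping : {A : Set} → WSeq A → (ℕ → ℕ) → WSeq A → Set
Grouping u g w =
  (∀ i → suc i <ℓ len w → g i ≤ g (suc i)) ×
  (∀ i → i <ℓ len w → g i ≤ℓ len u) ×
  (∀ i → i <ℓ len w → at w i ≡ segment (at u) (prev g i) (g i))

BoundedDiff : ℕ∞ → (ℕ → ℕ) → Set
BoundedDiff l g = ∃[ M ] (∀ i → suc i <ℓ l → g (suc i) ∸ g i ≤ M)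

data BExp (A : Set) : Set where
  ∅E   : BExp A
  εE   : BExp A
  ε̄E   : BExp A
  sym  : A → BExp A
  _·E_ : BExp A → BExp A → BExp A
  _+E_ : BExp A → BExp A → BExp A
  _*E  : BExp A → BExp A
  _ᴮE  : BExp A → BExp A

⟦_⟧B : {A : Set} → BExp A → WSeq A → Set
⟦ ∅E ⟧B w = len w ≡ fin 0
⟦ εE ⟧B w = ∀ i → i <ℓ len w → at w i ≡ []
⟦ ε̄E ⟧B w = (∃[ n ] len w ≡ fin n) × (∀ i → i <ℓ len w → at w i ≡ [])
⟦ sym a ⟧B w = ∀ i → i <ℓ len w → at w i ≡ [ a ]
⟦ K ·E L ⟧B w = ∃[ u ] ∃[ v ] (⟦ K ⟧B u × ⟦ L ⟧B v ×
  len u ≡ len w × len v ≡ len w ×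
  (∀ i → i <ℓ len w → at w i ≡ at u i ++ at v i))
⟦ K +E L ⟧B w = ∃[ u ] ∃[ v ] (⟦ K ⟧B u × ⟦ L ⟧B v ×
  len w ≡ max∞ (len u) (len v) ×
  (∀ i → i <ℓ len w →
     (i <ℓ len u × at w i ≡ at u i) ⊎ (i <ℓ len v × at w i ≡ at v i)))
⟦ K *E ⟧B w = ∃[ u ] ∃[ g ] (⟦ K ⟧B u × Grouping u g w)
⟦ K ᴮE ⟧B w = ∃[ u ] ∃[ g ] (⟦ K ⟧B u × Grouping u g w × BoundedDiff (len w) g)

data RExp (A : Set) : Set where
  ∅R   : RExp A
  εR   : RExp A
  symR : A → RExp A
  _·R_ : RExp A → RExp A → RExp A
  _+R_ : RExp A → RExp A → RExp A
  _*R  : RExp A → RExp A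

data _∈R_ {A : Set} : Word A → RExp A → Set where
  εR-in   : [] ∈R εR
  sym-in  : ∀ a → [ a ] ∈R symR a
  ·-in    : ∀ {u v e f} → u ∈R e → v ∈R f → (u ++ v) ∈R (e ·R f)
  +-inˡ   : ∀ {u e f} → u ∈R e → u ∈R (e +R f)
  +-inʳ   : ∀ {u e f} → u ∈R f → u ∈R (e +R f)
  *-nil   : ∀ {e} → [] ∈R (e *R)
  *-cons  : ∀ {u v e} → u ∈R e → v ∈R (e *R) → (u ++ v) ∈R (e *R)

ωWord : Set → Set
ωWord A = ℕ → A

_++ω_ : {A : Set} → Word A → ωWord A → ωWord A
([] ++ω y) i = y i
((a ∷ x) ++ω y) zero = a
((a ∷ x) ++ω y) (suc i) = (x ++ω y) i

pos : {A : Set} → (ℕ → Word A) → ℕ → ℕ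
pos u zero    = 0
pos u (suc i) = pos u i + length (u i)

InfNonempty : {A : Set} → (ℕ → Word A) → Set
InfNonempty u = ∀ N → ∃[ i ] (N ≤ i × u i ≢ [])

IsOmega : {A : Set} → (ℕ → Word A) → ωWord A → Set
IsOmega u y = InfNonempty u ×
  (∀ i (k : Fin (length (u i))) → y (pos u i + toℕ k) ≡ lookup (u i) k)

-- ωB-regular expressions  Σᵢ eᵢ · fᵢ^ω  and their languages

ωBExp : Set → Set
ωBExp A = List (RExp A × BExp A)

InEFω : {A : Set} → RExp A → BExp A → ωWord A → Set
InEFω e f w = ∃[ x ] ∃[ u ] ∃[ y ]
  (x ∈R e × ⟦ f ⟧B u × len u ≡ ∞ × IsOmega (at u) y × (∀ i → w i ≡ (x ++ω y) i))

⟦_⟧ω : {A : Set} → ωBExp A → ωWord A → Set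
⟦ es ⟧ω w = Any (λ p → InEFω (Data.Product.proj₁ p) (Data.Product.proj₂ p) w) es

data AB : Set where
  a b : AB

InfinitelyMany : {A : Set} → A → ωWord A → Set
InfinitelyMany c w = ∀ N → ∃[ i ] (N ≤ i × w i ≡ c)

aⁿb-blocks : (ℕ → ℕ) → ℕ → Word AB
aⁿb-blocks n i = replicate (n i) a ++ [ b ]

Bounded : (ℕ → ℕ) → Set
Bounded n = ∃[ M ] (∀ i → n i ≤ M)

module Submission where

open import Defs renaming (sym to symE)
open import Data.Nat using (ℕ; zero; suc; _+_; _*_; _∸_; _≤_; _<_; _≤′_; ≤′-refl; ≤′-step; z≤n; s≤s; _%_; _/_; NonZero)
open import Data.Nat.Properties
open import Data.Nat.DivMod using (m≡m%n+[m/n]*n; [m+kn]%n≡m%n; [m+n]%n≡m%n; m<n⇒m%n≡m; m%n<n; +-distrib-/-∣ʳ; m<n⇒m/n≡0; m*n/n≡m; n%1≡0; _mod_)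
open import Data.Nat.Divisibility using (divides-refl)
open import Data.Product using (Σ-syntax; ∃-syntax; _×_; _,_; proj₁; proj₂)
open import Data.Product using () renaming (map to map×)
open import Data.Sum using (_⊎_; inj₁; inj₂; [_,_]′)
open import Data.Unit using (tt)
open import Data.Empty using (⊥)
open import Data.Fin using (Fin; toℕ; fromℕ<) renaming (zero to fzero; suc to fsuc)
open import Data.Fin.Properties using (toℕ-fromℕ<; toℕ-injective; toℕ<n)
open import Data.List as List using (List; []; _∷_; _++_; length; lookup; replicate; [_]; map; concat; applyUpTo)
open import Data.List.Properties using (map-applyUpTo; length-++; length-replicate)
open import Data.List.Membership.Propositional using (_∈_)
open import Data.List.Membership.Propositional.Properties using (∈-lookup)
open import Data.List.Relation.Unary.Any using (index; here; there)
open import Data.List.Relation.Unary.Any.Properties using (lookup-index)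
open import Function using (_∘_)
open import Relation.Nullary using (¬_; Dec; yes; no; contradiction)
open import Relation.Nullary.Decidable using (_⊎-dec_; _×-dec_)
open import Relation.Binary.PropositionalEquality hiding ([_])

-- Call a window [m, n) of an infinite word sequence u ∈ ⟦ f ⟧ repeatable if the periodic
-- sequence u_m ⋯ u_{n-1} u_m ⋯ u_{n-1} ⋯ is again in ⟦ f ⟧. By induction on the B-regular
-- expression f, all windows are repeatable except those of a sparse family: any list of pairwise
-- disjoint windows contains a bounded number of them. Exceptions arise only from finite arguments
-- of a mix or a grouping (windows meeting their domain) and are pulled back along groupings; a
-- repeated window of a grouped sequence is a grouping of a repeated window of the underlying
-- sequence, in which each group length is a group length of the original grouping, so bounded
-- differences survive. Now if x u₀ u₁ ⋯ ∈ ⟦ e ⟧ · ⟦ f ⟧^ω has infinitely many b, infinitely many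
-- factors u_j contain b, and since the exceptions are counted, a bounded search finds such a
-- j with [j, j + 1) repeatable. Then x u_j u_j ⋯ is in the language, and its b's occur at
-- bounded distance, i.e. it is a word of (a^B b)^ω.

mono-from-step : ∀ {f : ℕ → ℕ} → (∀ i → f i ≤ f (suc i)) → ∀ {i k} → i ≤ k → f i ≤ f k
mono-from-step {f} step i≤k = go (≤⇒≤′ i≤k)
  where
  go : ∀ {i k} → i ≤′ k → f i ≤ f k
  go ≤′-refl = ≤-refl
  go (≤′-step i≤′k) = ≤-trans (go i≤′k) (step _)

module _ {d : ℕ} .{{_ : NonZero d}} {r : ℕ} (t : ℕ) (r<d : r < d) where

  [r+td]%d≡r : (r + t * d) % d ≡ r
  [r+td]%d≡r = trans ([m+kn]%n≡m%n r t d) (m<n⇒m%n≡m r<d)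

  [r+td]/d≡t : (r + t * d) / d ≡ t
  [r+td]/d≡t = begin
    (r + t * d) / d    ≡⟨ +-distrib-/-∣ʳ r (divides-refl t) ⟩
    r / d + t * d / d  ≡⟨ cong₂ _+_ (m<n⇒m/n≡0 r<d) (m*n/n≡m t d) ⟩
    t                  ∎
    where open ≡-Reasoning

module _ {e j : ℕ} where

  private
    j≡ : suc j ≡ suc (j % suc e) + j / suc e * suc e
    j≡ = cong suc (m≡m%n+[m/n]*n j (suc e))

  %/-suc : suc (j % suc e) < suc e → suc j % suc e ≡ suc (j % suc e) × suc j / suc e ≡ j / suc e
  %/-suc lt = subst (λ n → n % suc e ≡ suc (j % suc e)) (sym j≡) ([r+td]%d≡r (j / suc e) lt)
            , subst (λ n → n / suc e ≡ j / suc e) (sym j≡) ([r+td]/d≡t (j / suc e) lt)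

  %/-suc-wrap : suc (j % suc e) ≡ suc e → suc j % suc e ≡ 0 × suc j / suc e ≡ suc (j / suc e)
  %/-suc-wrap eq = subst (λ n → n % suc e ≡ 0) (sym j≡′) ([r+td]%d≡r {d = suc e} (suc (j / suc e)) (s≤s z≤n))
                 , subst (λ n → n / suc e ≡ suc (j / suc e)) (sym j≡′) ([r+td]/d≡t {d = suc e} (suc (j / suc e)) (s≤s z≤n))
    where
    j≡′ : suc j ≡ suc (j / suc e) * suc e
    j≡′ = trans j≡ (cong (_+ j / suc e * suc e) eq)

-- Repeating and regrouping windows

-- Groups of one period of length e + 1 end at offsets h 1, …, h (e + 1) = E + 1 of a period
-- of length E + 1; blocked j is the end of group j of the repetition.
module Blocked (e E : ℕ) (h : ℕ → ℕ) (h0 : h 0 ≡ 0) (he : h (suc e) ≡ suc E) where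

  blocked : ℕ → ℕ
  blocked j = j / suc e * suc E + h (suc (j % suc e))

  prev-blocked : ∀ j → prev blocked j ≡ j / suc e * suc E + h (j % suc e)
  prev-blocked zero = sym h0
  prev-blocked (suc j) with suc (j % suc e) <? suc e
  ... | yes lt = let %≡ , /≡ = %/-suc lt in
    sym (cong₂ (λ t r → t * suc E + h r) /≡ %≡)
  ... | no ≮ = let %≡ , /≡ = %/-suc-wrap wraps in begin
    t * suc E + h (suc (j % suc e))      ≡⟨ cong (λ r → t * suc E + h r) wraps ⟩
    t * suc E + h (suc e)                ≡⟨ cong (t * suc E +_) he ⟩
    t * suc E + suc E                    ≡⟨ +-comm (t * suc E) (suc E) ⟩
    suc t * suc E                        ≡⟨ sym (+-identityʳ _) ⟩
    suc t * suc E + 0                    ≡⟨ cong₂ (λ t r → t * suc E + r) (sym /≡) (sym (trans (cong h %≡) h0)) ⟩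
    suc j / suc e * suc E + h (suc j % suc e) ∎
    where
    open ≡-Reasoning
    t = j / suc e
    wraps : suc (j % suc e) ≡ suc e
    wraps = ≤-antisym (m%n<n j (suc e)) (≮⇒≥ ≮)

-- Repeats the window [m, m + e + 1); indexing by e keeps the period nonzero.
periodic : {A : Set} → (ℕ → Word A) → ℕ → ℕ → ℕ → Word A
periodic u m e i = u (m + i % suc e)

applyUpTo-cong : ∀ {A : Set} {f g : ℕ → A} n → (∀ k → k < n → f k ≡ g k) → applyUpTo f n ≡ applyUpTo g n
applyUpTo-cong zero    _   = refl
applyUpTo-cong (suc n) f≡g = cong₂ List._∷_ (f≡g 0 (s≤s z≤n)) (applyUpTo-cong n (λ k k<n → f≡g (suc k) (s≤s k<n)))

segment-cong : ∀ {A : Set} {u v : ℕ → Word A} {m n m′ n′} → n ∸ m ≡ n′ ∸ m′ →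
  (∀ k → k < n ∸ m → u (m + k) ≡ v (m′ + k)) → segment u m n ≡ segment v m′ n′
segment-cong {u = u} {v} {m} {n} {m′} {n′} len≡ u≡v = begin
  concat (map u (applyUpTo (m +_) (n ∸ m)))     ≡⟨ cong concat (map-applyUpTo (m +_) u (n ∸ m)) ⟩
  concat (applyUpTo (u ∘ (m +_)) (n ∸ m))       ≡⟨ cong concat (applyUpTo-cong (n ∸ m) u≡v) ⟩
  concat (applyUpTo (v ∘ (m′ +_)) (n ∸ m))      ≡⟨ cong (concat ∘ applyUpTo (v ∘ (m′ +_))) len≡ ⟩
  concat (applyUpTo (v ∘ (m′ +_)) (n′ ∸ m′))    ≡⟨ cong concat (map-applyUpTo (m′ +_) v (n′ ∸ m′)) ⟨
  concat (map v (applyUpTo (m′ +_) (n′ ∸ m′)))  ∎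
  where open ≡-Reasoning

segment-periodic : ∀ {A : Set} (u : ℕ → Word A) s E t {x y} → x ≤ y → y ≤ suc E →
  segment (periodic u s E) (t * suc E + x) (t * suc E + y) ≡ segment u (s + x) (s + y)
segment-periodic u s E t {x} {y} x≤y y≤ =
  segment-cong {u = periodic u s E} {m = t * suc E + x} {t * suc E + y} {s + x} {s + y}
    (trans ([m+n]∸[m+o]≡n∸o (t * suc E) y x) (sym ([m+n]∸[m+o]≡n∸o s y x))) same
  where
  same : ∀ k → k < (t * suc E + y) ∸ (t * suc E + x) → periodic u s E (t * suc E + x + k) ≡ u (s + x + k)
  same k k< = cong u (begin
    s + (t * suc E + x + k) % suc E  ≡⟨ cong (λ n → s + n % suc E) (trans (+-assoc (t * suc E) x k) (+-comm (t * suc E) (x + k))) ⟩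
    s + (x + k + t * suc E) % suc E  ≡⟨ cong (s +_) ([r+td]%d≡r t (<-≤-trans x+k<y y≤)) ⟩
    s + (x + k)                      ≡⟨ +-assoc s x k ⟨
    s + x + k                        ∎)
    where
    open ≡-Reasoning
    x+k<y : x + k < y
    x+k<y = subst (x + k <_) (m+[n∸m]≡n x≤y)
              (+-monoʳ-< x (subst (k <_) ([m+n]∸[m+o]≡n∸o (t * suc E) y x) k<))

segment-empty : ∀ {A : Set} (u : ℕ → Word A) {m n} → n ≤ m → segment u m n ≡ []
segment-empty u {m} n≤m = cong (λ L → concat (map u (applyUpTo (m +_) L))) (m≤n⇒m∸n≡0 n≤m)

module Grouped {A : Set} {u w : ℕ → Word A} {g : ℕ → ℕ}
  (g-step : ∀ i → g i ≤ g (suc i)) (w≡ : ∀ i → w i ≡ segment u (prev g i) (g i)) where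

  prev-step : ∀ i → prev g i ≤ prev g (suc i)
  prev-step zero    = z≤n
  prev-step (suc i) = g-step i

  prev-mono : ∀ {i k} → i ≤ k → prev g i ≤ prev g k
  prev-mono = mono-from-step prev-step

  empty-window : ∀ m e → prev g (m + suc e) ≤ prev g m → ∀ i → periodic w m e i ≡ []
  empty-window m e collapsed i = trans (w≡ (m + r)) (segment-empty u (begin
    g (m + r)          ≤⟨ prev-mono (subst (_≤ m + suc e) (+-suc m r) (+-monoʳ-≤ m (m%n<n i (suc e)))) ⟩
    prev g (m + suc e) ≤⟨ collapsed ⟩
    prev g m           ≤⟨ prev-mono (m≤m+n m r) ⟩
    prev g (m + r)     ∎))
    where
    open ≤-Reasoning
    r = i % suc e

  gap-bound : ∀ {M} → (∀ i → g (suc i) ∸ g i ≤ M) → ∀ i → g i ∸ prev g i ≤ g 0 + M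
  gap-bound bd zero    = m≤m+n (g 0) _
  gap-bound bd (suc i) = ≤-trans (bd i) (m≤n+m _ (g 0))

  module Window (m e E : ℕ) (span : prev g m + suc E ≡ prev g (m + suc e)) where

    offset : ℕ → ℕ
    offset r = prev g (m + r) ∸ prev g m

    private
      below : ∀ r → prev g m ≤ prev g (m + r)
      below r = prev-mono (m≤m+n m r)

      offset-0 : offset 0 ≡ 0
      offset-0 = trans (cong (λ i → prev g i ∸ prev g m) (+-identityʳ m)) (n∸n≡0 (prev g m))

      offset-e : offset (suc e) ≡ suc E
      offset-e = trans (cong (_∸ prev g m) (sym span)) (m+n∸m≡n (prev g m) (suc E))

      offset-step : ∀ r → offset r ≤ offset (suc r)
      offset-step r = ∸-monoˡ-≤ (prev g m) (prev-mono (+-monoʳ-≤ m (n≤1+n r)))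

    open Blocked e E offset offset-0 offset-e public

    private
      offset-≤ : ∀ {r} → r < suc e → offset (suc r) ≤ suc E
      offset-≤ {r} r<d = subst (offset (suc r) ≤_) offset-e (mono-from-step offset-step r<d)

      lower : ∀ r → prev g m + offset r ≡ prev g (m + r)
      lower r = m+[n∸m]≡n (below r)

      upper : ∀ r → prev g m + offset (suc r) ≡ g (m + r)
      upper r = trans (lower (suc r)) (cong (prev g) (+-suc m r))

    blocked-step : ∀ j → blocked j ≤ blocked (suc j)
    blocked-step j = subst (_≤ blocked (suc j)) (sym (prev-blocked (suc j)))
      (+-monoʳ-≤ (suc j / suc e * suc E) (offset-step (suc j % suc e)))

    grouped : ∀ j → periodic w m e j ≡ segment (periodic u (prev g m) E) (prev blocked j) (blocked j)
    grouped j = begin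
      w (m + r)                                             ≡⟨ w≡ (m + r) ⟩
      segment u (prev g (m + r)) (g (m + r))                ≡⟨ cong₂ (segment u) (lower r) (upper r) ⟨
      segment u (prev g m + offset r) (prev g m + offset (suc r))
        ≡⟨ segment-periodic u (prev g m) E t (offset-step r) (offset-≤ (m%n<n j (suc e))) ⟨
      segment (periodic u (prev g m) E) (t * suc E + offset r) (blocked j)
        ≡⟨ cong (λ x → segment (periodic u (prev g m) E) x (blocked j)) (prev-blocked j) ⟨
      segment (periodic u (prev g m) E) (prev blocked j) (blocked j) ∎
      where
      open ≡-Reasoning
      t = j / suc e
      r = j % suc e

    blocked-bounded : ∀ {M} → (∀ i → g (suc i) ∸ g i ≤ M) → ∀ j → blocked (suc j) ∸ blocked j ≤ g 0 + M
    blocked-bounded {M} bd j = subst (_≤ g 0 + M) (sym diff) (gap-bound bd (m + r))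
      where
      open ≡-Reasoning
      t = suc j / suc e
      r = suc j % suc e
      diff : blocked (suc j) ∸ blocked j ≡ g (m + r) ∸ prev g (m + r)
      diff = begin
        blocked (suc j) ∸ blocked j                            ≡⟨ cong (blocked (suc j) ∸_) (prev-blocked (suc j)) ⟩
        (t * suc E + offset (suc r)) ∸ (t * suc E + offset r)  ≡⟨ [m+n]∸[m+o]≡n∸o (t * suc E) _ _ ⟩
        offset (suc r) ∸ offset r                              ≡⟨ [m+n]∸[m+o]≡n∸o (prev g m) _ _ ⟨
        (prev g m + offset (suc r)) ∸ (prev g m + offset r)    ≡⟨ cong₂ _∸_ (upper r) (lower r) ⟩
        g (m + r) ∸ prev g (m + r)                             ∎

-- Sparse families of windows

-- A window (m , n) stands for the index interval [m, n).
data Ascending : ℕ → List (ℕ × ℕ) → Set where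
  []  : ∀ {lo} → Ascending lo []
  _∷_ : ∀ {lo m n ws} → lo ≤ m × m ≤ n → Ascending n ws → Ascending lo ((m , n) ∷ ws)

count : {P : ℕ → ℕ → Set} → (∀ m n → Dec (P m n)) → List (ℕ × ℕ) → ℕ
count P? []             = 0
count P? ((m , n) ∷ ws) with P? m n
... | yes _ = suc (count P? ws)
... | no  _ = count P? ws

count-⊎ : {P Q : ℕ → ℕ → Set} (P? : ∀ m n → Dec (P m n)) (Q? : ∀ m n → Dec (Q m n)) →
  ∀ ws → count (λ m n → P? m n ⊎-dec Q? m n) ws ≤ count P? ws + count Q? ws
count-⊎ P? Q? [] = z≤n
count-⊎ P? Q? ((m , n) ∷ ws) with P? m n | Q? m n
... | yes _ | yes _ = s≤s (≤-trans (count-⊎ P? Q? ws) (+-monoʳ-≤ (count P? ws) (n≤1+n _)))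
... | yes _ | no  _ = s≤s (count-⊎ P? Q? ws)
... | no  _ | yes _ = subst (suc (count (λ m n → P? m n ⊎-dec Q? m n) ws) ≤_) (sym (+-suc (count P? ws) (count Q? ws))) (s≤s (count-⊎ P? Q? ws))
... | no  _ | no  _ = count-⊎ P? Q? ws

count-preimage : {P : ℕ → ℕ → Set} (P? : ∀ m n → Dec (P m n)) (q : ℕ → ℕ) →
  ∀ ws → count (λ m n → P? (q m) (q n)) ws ≡ count P? (List.map (map× q q) ws)
count-preimage P? q []             = refl
count-preimage P? q ((m , n) ∷ ws) with P? (q m) (q n)
... | yes _ = cong suc (count-preimage P? q ws)
... | no  _ = count-preimage P? q ws

Ascending-map : ∀ {q : ℕ → ℕ} → (∀ {i k} → i ≤ k → q i ≤ q k) →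
  ∀ {lo ws} → Ascending lo ws → Ascending (q lo) (List.map (map× q q) ws)
Ascending-map q-mono []                   = []
Ascending-map q-mono ((lo≤m , m≤n) ∷ ws) = (q-mono lo≤m , q-mono m≤n) ∷ Ascending-map q-mono ws

Meeting : ℕ → ℕ → ℕ → Set
Meeting ℓ m n = m < n × m < ℓ

meeting? : ∀ ℓ m n → Dec (Meeting ℓ m n)
meeting? ℓ m n = (m <? n) ×-dec (m <? ℓ)

count-meeting : ∀ ℓ {lo ws} → Ascending lo ws → count (meeting? ℓ) ws ≤ ℓ ∸ lo
count-meeting ℓ [] = z≤n
count-meeting ℓ {lo} (_∷_ {m = m} {n} {ws} (lo≤m , m≤n) ws↑) with meeting? ℓ m n
... | yes (m<n , m<ℓ) = begin
  suc (count (meeting? ℓ) ws)  ≤⟨ s≤s (count-meeting ℓ ws↑) ⟩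
  suc (ℓ ∸ n)                  ≤⟨ s≤s (∸-monoʳ-≤ ℓ m<n) ⟩
  suc (ℓ ∸ suc m)              ≡⟨ +-∸-assoc 1 m<ℓ ⟨
  ℓ ∸ m                        ≤⟨ ∸-monoʳ-≤ ℓ lo≤m ⟩
  ℓ ∸ lo                       ∎
  where open ≤-Reasoning
... | no _ = ≤-trans (count-meeting ℓ ws↑) (∸-monoʳ-≤ ℓ (≤-trans lo≤m m≤n))

record SparseWindows : Set₁ where
  field
    Bad    : ℕ → ℕ → Set
    bad?   : ∀ m n → Dec (Bad m n)
    budget : ℕ
    sparse : ∀ {lo} ws → Ascending lo ws → count bad? ws ≤ budget
open SparseWindows

no-windows : SparseWindows
no-windows = record { Bad = λ _ _ → ⊥ ; bad? = λ _ _ → no λ () ; budget = 0 ; sparse = none }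
  where
  none : ∀ {lo} ws → Ascending lo ws → count (λ _ _ → no λ ()) ws ≤ 0
  none []       []        = z≤n
  none (_ ∷ ws) (_ ∷ ws↑) = none ws ws↑

_∪ʷ_ : SparseWindows → SparseWindows → SparseWindows
S ∪ʷ T = record
  { Bad    = λ m n → Bad S m n ⊎ Bad T m n
  ; bad?   = λ m n → bad? S m n ⊎-dec bad? T m n
  ; budget = budget S + budget T
  ; sparse = λ ws ws↑ → ≤-trans (count-⊎ (bad? S) (bad? T) ws) (+-mono-≤ (sparse S ws ws↑) (sparse T ws ws↑))
  }

preimage : (q : ℕ → ℕ) → (∀ {i k} → i ≤ k → q i ≤ q k) → SparseWindows → SparseWindows
preimage q q-mono S = record
  { Bad    = λ m n → Bad S (q m) (q n)
  ; bad?   = λ m n → bad? S (q m) (q n)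
  ; budget = budget S
  ; sparse = λ ws ws↑ → subst (_≤ budget S) (sym (count-preimage (bad? S) q ws))
                                (sparse S _ (Ascending-map q-mono ws↑))
  }

meeting : ℕ → SparseWindows
meeting ℓ = record
  { Bad    = Meeting ℓ
  ; bad?   = meeting? ℓ
  ; budget = ℓ
  ; sparse = λ {lo} _ ws↑ → ≤-trans (count-meeting ℓ ws↑) (m∸n≤m ℓ lo)
  }

bad-window-spends : (S : SparseWindows) {lo m n k : ℕ} → Bad S m n → lo ≤ m → m ≤ n →
  (∀ ws → Ascending lo ws → count (bad? S) ws ≤ k) → ∀ ws → Ascending n ws → suc (count (bad? S) ws) ≤ k
bad-window-spends S {lo} {m} {n} bad lo≤m m≤n bound ws ws↑ with bound ((m , n) ∷ ws) ((lo≤m , m≤n) ∷ ws↑)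
... | counted with bad? S m n
...   | yes _   = counted
...   | no good = contradiction bad good

unit-window-avoiding : (S : SparseWindows) {P : ℕ → Set} → (∀ N → ∃[ j ] (N ≤ j × P j)) →
  ∃[ j ] (P j × ¬ Bad S j (j + 1))
unit-window-avoiding S {P} often = search (budget S) 0 (sparse S)
  where
  search : ∀ k lo → (∀ ws → Ascending lo ws → count (bad? S) ws ≤ k) → ∃[ j ] (P j × ¬ Bad S j (j + 1))
  search k lo bound with often lo
  ... | j , lo≤j , Pj with bad? S j (j + 1) | k
  ...   | no good | _      = j , Pj , good
  ...   | yes bad | zero   = contradiction (bad-window-spends S bad lo≤j (m≤m+n j 1) bound [] []) λ ()
  ...   | yes bad | suc k′ = search k′ (j + 1) λ ws ws↑ → ≤-pred (bad-window-spends S bad lo≤j (m≤m+n j 1) bound ws ws↑)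

-- Repeatable windows

record Repeatable {A : Set} (f : BExp A) (u : ℕ → Word A) : Set₁ where
  field
    exceptions : SparseWindows
    repeat     : ∀ m e → ¬ Bad exceptions m (m + suc e) → ⟦ f ⟧B (wseq ∞ (periodic u m e))
open Repeatable

0≤ℓ : ∀ l → 0 ≤ℓ l
0≤ℓ (fin _) = z≤n
0≤ℓ ∞       = tt

Grouping-collapsed : ∀ {A : Set} (v : WSeq A) {w : ℕ → Word A} → (∀ i → w i ≡ []) → Grouping v (λ _ → 0) (wseq ∞ w)
Grouping-collapsed v w≡[] = (λ _ _ → z≤n) , (λ _ _ → 0≤ℓ (len v)) , λ i _ → trans (w≡[] i) (sym (segment-empty (at v) {prev (λ _ → 0) i} z≤n))

Regrouping : {A : Set} → BExp A → (ℕ → ℕ) → (ℕ → Word A) → Set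
Regrouping K g w = ∃[ v ] ∃[ g′ ] (⟦ K ⟧B v × Grouping v g′ (wseq ∞ w) × (BoundedDiff ∞ g → BoundedDiff ∞ g′))

StarWindows : {A : Set} → BExp A → (ℕ → ℕ) → (ℕ → Word A) → Set₁
StarWindows K g w = Σ[ S ∈ SparseWindows ] (∀ m e → ¬ Bad S m (m + suc e) → Regrouping K g (periodic w m e))

module StarGrouping {A : Set} {K : BExp A} {w : ℕ → Word A} {g : ℕ → ℕ}
  (v : WSeq A) (v∈K : ⟦ K ⟧B v) (grp : Grouping v g (wseq ∞ w)) where

  open Grouped (λ i → proj₁ grp i tt) (λ i → proj₂ (proj₂ grp) i tt) public

  collapsed : ∀ m e → ¬ prev g m < prev g (m + suc e) → Regrouping K g (periodic w m e)
  collapsed m e ≮ = v , (λ _ → 0) , v∈K , Grouping-collapsed v (empty-window m e (≮⇒≥ ≮)) , λ _ → 0 , λ _ _ → z≤n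

star-windows : {A : Set} {K : BExp A} {w : ℕ → Word A} {g : ℕ → ℕ} (v : WSeq A) → ⟦ K ⟧B v →
  (len v ≡ ∞ → Repeatable K (at v)) → Grouping v g (wseq ∞ w) → StarWindows K g w
star-windows {K = K} {w} {g} v@(wseq ∞ u) v∈K IH grp = preimage (prev g) prev-mono (exceptions R) , window
  where
  open StarGrouping v v∈K grp
  R = IH refl
  window : ∀ m e → ¬ Bad (exceptions R) (prev g m) (prev g (m + suc e)) → Regrouping K g (periodic w m e)
  window m e ok with prev g m <? prev g (m + suc e)
  ... | no ≮     = collapsed m e ≮
  ... | yes less = wseq ∞ (periodic u (prev g m) E) , blocked
                 , repeat R (prev g m) E (ok ∘ subst (Bad (exceptions R) (prev g m)) span)
                 , ((λ j _ → blocked-step j) , (λ _ _ → tt) , λ j _ → grouped j)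
                 , λ { (M , bd) → g 0 + M , λ j _ → blocked-bounded (λ i → bd i tt) j }
    where
    E = prev g (m + suc e) ∸ suc (prev g m)
    span : prev g m + suc E ≡ prev g (m + suc e)
    span = trans (+-suc (prev g m) E) (m+[n∸m]≡n less)
    open Window m e E span
star-windows {K = K} {w} {g} v@(wseq (fin ℓ) u) v∈K _ grp = preimage (prev g) prev-mono (meeting ℓ) , window
  where
  open StarGrouping v v∈K grp
  prev≤ℓ : ∀ i → prev g i ≤ ℓ
  prev≤ℓ zero    = z≤n
  prev≤ℓ (suc i) = proj₁ (proj₂ grp) i tt
  window : ∀ m e → ¬ Meeting ℓ (prev g m) (prev g (m + suc e)) → Regrouping K g (periodic w m e)
  window m e ok with prev g m <? prev g (m + suc e)
  ... | no ≮     = collapsed m e ≮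
  ... | yes less = contradiction (less , <-≤-trans less (prev≤ℓ (m + suc e))) ok

¬Meeting⇒≮ : ∀ {ℓ m} e → ¬ Meeting ℓ m (m + suc e) → ∀ r → ¬ m + r < ℓ
¬Meeting⇒≮ {m = m} e outside r m+r<ℓ = outside (m+1+e>m , ≤-<-trans (m≤m+n m r) m+r<ℓ)
  where
  m+1+e>m : m < m + suc e
  m+1+e>m = subst (m <_) (sym (+-suc m e)) (s≤s (m≤m+n m e))

repeatable : {A : Set} (f : BExp A) (w : WSeq A) → ⟦ f ⟧B w → len w ≡ ∞ → Repeatable f (at w)
repeatable ∅E (wseq .∞ _) () refl
repeatable ε̄E (wseq .∞ _) ((_ , ()) , _) refl
repeatable εE (wseq .∞ w) w∈ refl = record
  { exceptions = no-windows ; repeat = λ m e _ i _ → w∈ (m + i % suc e) tt }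
repeatable (symE _) (wseq .∞ w) w∈ refl = record
  { exceptions = no-windows ; repeat = λ m e _ i _ → w∈ (m + i % suc e) tt }
repeatable (K ·E L) (wseq .∞ w) (u , v , u∈K , v∈L , u∞ , v∞ , w≡) refl = record
  { exceptions = exceptions RK ∪ʷ exceptions RL
  ; repeat     = λ m e ok → wseq ∞ (periodic (at u) m e) , wseq ∞ (periodic (at v) m e)
                          , repeat RK m e (ok ∘ inj₁) , repeat RL m e (ok ∘ inj₂) , refl , refl
                          , λ i _ → w≡ (m + i % suc e) tt
  }
  where
  RK = repeatable K u u∈K u∞
  RL = repeatable L v v∈L v∞
repeatable (K +E L) (wseq .∞ w) (wseq ∞ u , wseq ∞ v , u∈K , v∈L , _ , w∈) refl = record
  { exceptions = exceptions RK ∪ʷ exceptions RL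
  ; repeat     = λ m e ok → wseq ∞ (periodic u m e) , wseq ∞ (periodic v m e)
                          , repeat RK m e (ok ∘ inj₁) , repeat RL m e (ok ∘ inj₂) , refl
                          , λ i _ → w∈ (m + i % suc e) tt
  }
  where
  RK = repeatable K (wseq ∞ u) u∈K refl
  RL = repeatable L (wseq ∞ v) v∈L refl
repeatable (K +E L) (wseq .∞ w) (wseq ∞ u , wseq (fin ℓ) v , u∈K , v∈L , _ , w∈) refl = record
  { exceptions = exceptions RK ∪ʷ meeting ℓ
  ; repeat     = λ m e ok → wseq ∞ (periodic u m e) , wseq (fin ℓ) v
                          , repeat RK m e (ok ∘ inj₁) , v∈L , refl
                          , λ i _ → [ inj₁ , (λ (lt , _) → contradiction lt (¬Meeting⇒≮ e (ok ∘ inj₂) (i % suc e))) ]′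
                                      (w∈ (m + i % suc e) tt)
  }
  where
  RK = repeatable K (wseq ∞ u) u∈K refl
repeatable (K +E L) (wseq .∞ w) (wseq (fin ℓ) u , wseq ∞ v , u∈K , v∈L , _ , w∈) refl = record
  { exceptions = meeting ℓ ∪ʷ exceptions RL
  ; repeat     = λ m e ok → wseq (fin ℓ) u , wseq ∞ (periodic v m e)
                          , u∈K , repeat RL m e (ok ∘ inj₂) , refl
                          , λ i _ → [ (λ (lt , _) → contradiction lt (¬Meeting⇒≮ e (ok ∘ inj₁) (i % suc e))) , inj₂ ]′
                                      (w∈ (m + i % suc e) tt)
  }
  where
  RL = repeatable L (wseq ∞ v) v∈L refl
repeatable (K +E L) (wseq .∞ w) (wseq (fin _) _ , wseq (fin _) _ , _ , _ , () , _) refl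
repeatable (K *E) (wseq .∞ w) (v , g , v∈K , grp) refl = record
  { exceptions = proj₁ SW
  ; repeat     = λ m e ok → let v′ , g′ , v′∈K , grp′ , _ = proj₂ SW m e ok in v′ , g′ , v′∈K , grp′
  }
  where SW = star-windows v v∈K (repeatable K v v∈K) grp
repeatable (K ᴮE) (wseq .∞ w) (v , g , v∈K , grp , bounded) refl = record
  { exceptions = proj₁ SW
  ; repeat     = λ m e ok → let v′ , g′ , v′∈K , grp′ , bounded′ = proj₂ SW m e ok in v′ , g′ , v′∈K , grp′ , bounded′ bounded
  }
  where SW = star-windows v v∈K (repeatable K v v∈K) grp

-- Factorisations of ω-words

++ω-drop : ∀ {A : Set} (x : Word A) (y : ωWord A) i → (x ++ω y) (length x + i) ≡ y i
++ω-drop []      y i = refl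
++ω-drop (_ ∷ x) y i = ++ω-drop x y i

module Factors {A : Set} (u : ℕ → Word A) where

  pos-mono : ∀ {i k} → i ≤ k → pos u i ≤ pos u k
  pos-mono = mono-from-step (λ i → m≤m+n (pos u i) (length (u i)))

  pos-unbounded : InfNonempty u → ∀ K → ∃[ J ] (K ≤ pos u J)
  pos-unbounded often zero = 0 , z≤n
  pos-unbounded often (suc K) with pos-unbounded often K
  ... | J , K≤ with often J
  ... | i , J≤i , nonempty = suc i , ≤-<-trans (≤-trans K≤ (pos-mono J≤i)) (m<m+n (pos u i) (0<length (u i) nonempty))
    where
    0<length : (z : Word A) → z ≢ [] → 0 < length z
    0<length []      ≢[] = contradiction refl ≢[]
    0<length (_ ∷ _) _   = s≤s z≤n

  factor-containing : ∀ N q J → q < pos u J → pos u N ≤ q → ∃[ j ] (N ≤ j × pos u j ≤ q × q < pos u (suc j))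
  factor-containing N q (suc J) q< N≤q with q <? pos u J
  ... | yes q<′ = factor-containing N q J q<′ N≤q
  ... | no  q≮  = J , ≮⇒≥ (λ J<N → <-irrefl refl (<-≤-trans q< (≤-trans (pos-mono J<N) N≤q))) , ≮⇒≥ q≮ , q<

  letter-in-factor : ∀ {y} → IsOmega u y → ∀ N q → pos u N ≤ q → ∃[ j ] (N ≤ j × y q ∈ u j)
  letter-in-factor {y} (often , y≡) N q N≤q with pos-unbounded often (suc q)
  ... | J , q<J with factor-containing N q J q<J N≤q
  ... | j , N≤j , start≤q , q<end = j , N≤j , subst (_∈ u j) lookup≡ (∈-lookup k)
    where
    k : Fin (length (u j))
    k = fromℕ< (subst (q ∸ pos u j <_) (m+n∸m≡n (pos u j) (length (u j))) (∸-monoˡ-< q<end start≤q))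
    lookup≡ : lookup (u j) k ≡ y q
    lookup≡ = trans (sym (y≡ j k)) (cong y (trans (cong (pos u j +_) (toℕ-fromℕ< _)) (m+[n∸m]≡n start≤q)))

factors-containing-b : ∀ {x : Word AB} {u : ℕ → Word AB} {y w : ωWord AB} → IsOmega u y →
  (∀ i → w i ≡ (x ++ω y) i) → InfinitelyMany b w → ∀ N → ∃[ j ] (N ≤ j × b ∈ u j)
factors-containing-b {x} {u} {y} {w} y=Πu w≡ often N with often (length x + pos u N)
... | p , x+N≤p , wp≡b with Factors.letter-in-factor u {y} y=Πu N (p ∸ length x) (m+n≤o⇒m≤o∸n (pos u N) (subst (_≤ p) (+-comm (length x) (pos u N)) x+N≤p))
... | j , N≤j , yq∈ = j , N≤j , subst (_∈ u j) yq≡b yq∈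
  where
  x≤p : length x ≤ p
  x≤p = ≤-trans (m≤m+n (length x) (pos u N)) x+N≤p
  yq≡b : y (p ∸ length x) ≡ b
  yq≡b = trans (sym (++ω-drop x y (p ∸ length x))) (trans (cong (x ++ω y) (m+[n∸m]≡n x≤p)) (trans (sym (w≡ p)) wp≡b))

cycle : {A : Set} → A → Word A → ωWord A
cycle c zs i = lookup (c ∷ zs) (i mod suc (length zs))

IsOmega-constant : ∀ {A : Set} {u : ℕ → Word A} {c zs} → (∀ i → u i ≡ c ∷ zs) → IsOmega u (cycle c zs)
IsOmega-constant {u = u} {c} {zs} u≡ = (λ N → N , ≤-refl , λ uN≡[] → ∷≢[] (trans (sym (u≡ N)) uN≡[])) , entries
  where
  d = suc (length zs)
  ∷≢[] : c ∷ zs ≢ []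
  ∷≢[] ()
  pos≡ : ∀ i → pos u i ≡ i * d
  pos≡ zero    = refl
  pos≡ (suc i) = trans (cong₂ _+_ (pos≡ i) (cong length (u≡ i))) (+-comm (i * d) d)
  entries : ∀ i (k : Fin (length (u i))) → cycle c zs (pos u i + toℕ k) ≡ lookup (u i) k
  entries i k with u i | u≡ i
  ... | .(c ∷ zs) | refl = cong (lookup (c ∷ zs)) (toℕ-injective (begin
    toℕ ((pos u i + toℕ k) mod d)  ≡⟨ toℕ-fromℕ< _ ⟩
    (pos u i + toℕ k) % d          ≡⟨ cong (λ n → (n + toℕ k) % d) (pos≡ i) ⟩
    (i * d + toℕ k) % d            ≡⟨ cong (_% d) (+-comm (i * d) (toℕ k)) ⟩
    (toℕ k + i * d) % d            ≡⟨ [r+td]%d≡r i (toℕ<n k) ⟩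
    toℕ k                          ∎))
    where open ≡-Reasoning

residue-within : ∀ {e r} → r < suc e → ∀ p → ∃[ k ] (k < suc e × (p + k) % suc e ≡ r)
residue-within {e} {r} r<d zero = r , r<d , m<n⇒m%n≡m r<d
residue-within {e} {r} r<d (suc p) with residue-within r<d p
... | suc k , k<d , ≡r = k , <-trans (n<1+n k) k<d , trans (cong (_% suc e) (sym (+-suc p k))) ≡r
... | zero  , _   , ≡r = e , n<1+n e , (begin
  (suc p + e) % suc e  ≡⟨ cong (_% suc e) (+-comm (suc p) e) ⟩
  (e + suc p) % suc e  ≡⟨ cong (_% suc e) (trans (+-suc e p) (+-comm (suc e) p)) ⟩
  (p + suc e) % suc e  ≡⟨ [m+n]%n≡m%n p (suc e) ⟩
  p % suc e            ≡⟨ cong (_% suc e) (+-identityʳ p) ⟨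
  (p + 0) % suc e      ≡⟨ ≡r ⟩
  r                    ∎)
  where open ≡-Reasoning

letter-within-period : ∀ {A : Set} {l c : A} {zs} → l ∈ c ∷ zs → ∀ (x : Word A) p →
  ∃[ k ] (k < length x + suc (length zs) × (x ++ω cycle c zs) (p + k) ≡ l)
letter-within-period {l = l} {c} {zs} l∈ x p with residue-within (toℕ<n (index l∈)) p
... | k , k<d , ≡i = length x + k , +-monoʳ-< (length x) k<d , (begin
  (x ++ω cycle c zs) (p + (length x + k))        ≡⟨ cong (x ++ω cycle c zs) (trans (sym (+-assoc p (length x) k))
                                                     (trans (cong (_+ k) (+-comm p (length x))) (+-assoc (length x) p k))) ⟩
  (x ++ω cycle c zs) (length x + (p + k))        ≡⟨ ++ω-drop x (cycle c zs) (p + k) ⟩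
  lookup (c ∷ zs) ((p + k) mod suc (length zs))  ≡⟨ cong (lookup (c ∷ zs)) (toℕ-injective (trans (toℕ-fromℕ< _) ≡i)) ⟩
  lookup (c ∷ zs) (index l∈)                     ≡⟨ lookup-index l∈ ⟨
  l                                              ∎)
  where open ≡-Reasoning

module Runs (v : ωWord AB) where

  a-run : ℕ → ℕ → ℕ
  a-run zero    p = 0
  a-run (suc K) p with v p
  ... | a = suc (a-run K (suc p))
  ... | b = 0

  a-run-≤ : ∀ K p → a-run K p ≤ K
  a-run-≤ zero    p = z≤n
  a-run-≤ (suc K) p with v p
  ... | a = s≤s (a-run-≤ K (suc p))
  ... | b = z≤n

  a-run-a : ∀ K p i → i < a-run K p → v (p + i) ≡ a
  a-run-a (suc K) p i i< with v p in vp
  a-run-a (suc K) p zero    _        | a = trans (cong v (+-identityʳ p)) vp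
  a-run-a (suc K) p (suc i) (s≤s i<) | a = trans (cong v (+-suc p i)) (a-run-a K (suc p) i i<)

  a-run-b : ∀ K p → ∃[ k ] (k < K × v (p + k) ≡ b) → v (p + a-run K p) ≡ b
  a-run-b (suc K) p (k , k< , vk) with v p in vp
  ... | b = trans (cong v (+-identityʳ p)) vp
  ... | a with k
  ...   | zero  = contradiction (trans (sym vp) (trans (cong v (sym (+-identityʳ p))) vk)) λ ()
  ...   | suc k = trans (cong v (+-suc p _)) (a-run-b K (suc p) (k , ≤-pred k< , trans (cong v (sym (+-suc p k))) vk))

block-lookup : ∀ m (f : ℕ → AB) → (∀ j → j < m → f j ≡ a) → f m ≡ b →
  ∀ k → f (toℕ k) ≡ lookup (replicate m a ++ [ b ]) k
block-lookup zero    f as fm fzero    = fm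
block-lookup (suc m) f as fm fzero    = as 0 (s≤s z≤n)
block-lookup (suc m) f as fm (fsuc k) = block-lookup m (f ∘ suc) (λ j j< → as (suc j) (s≤s j<)) fm k

aⁿb-decomposition : ∀ K (v : ωWord AB) → (∀ p → ∃[ k ] (k < K × v (p + k) ≡ b)) →
  ∃[ n ] (Bounded n × IsOmega (aⁿb-blocks n) v)
aⁿb-decomposition K v dense = n , (K , λ i → a-run-≤ K (start i)) , (λ N → N , ≤-refl , block≢[] (n N)) , entries
  where
  open Runs v
  start : ℕ → ℕ
  n : ℕ → ℕ
  start zero    = 0
  start (suc i) = start i + suc (n i)
  n i = a-run K (start i)

  block≢[] : ∀ m → replicate m a ++ [ b ] ≢ []
  block≢[] zero    ()
  block≢[] (suc m) ()

  pos≡ : ∀ i → pos (aⁿb-blocks n) i ≡ start i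
  pos≡ zero    = refl
  pos≡ (suc i) = cong₂ _+_ (pos≡ i) (trans (length-++ (replicate (n i) a))
                                         (trans (cong (_+ 1) (length-replicate (n i))) (+-comm (n i) 1)))

  entries : ∀ i (k : Fin (length (aⁿb-blocks n i))) → v (pos (aⁿb-blocks n) i + toℕ k) ≡ lookup (aⁿb-blocks n i) k
  entries i k = trans (cong (λ s → v (s + toℕ k)) (pos≡ i))
    (block-lookup (n i) (λ j → v (start i + j)) (a-run-a K (start i)) (a-run-b K (start i) (dense (start i))) k)

Meets-aᴮbω : (ωWord AB → Set) → Set
Meets-aᴮbω L = ∃[ n ] ∃[ v ] (Bounded n × IsOmega (aⁿb-blocks n) v × L v)

Meets-aᴮbω-mono : ∀ {L L′ : ωWord AB → Set} → (∀ {v} → L v → L′ v) → Meets-aᴮbω L → Meets-aᴮbω L′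
Meets-aᴮbω-mono L⊆L′ (n , v , bounded , blocks , v∈L) = n , v , bounded , blocks , L⊆L′ v∈L

summand : ∀ e f w → InEFω e f w → InfinitelyMany b w → Meets-aᴮbω (InEFω e f)
summand e f w (x , u , y , x∈e , u∈f , u∞ , y=Πu , w≡) often = pump (at u j) refl b∈uj
  where
  R = repeatable f u u∈f u∞
  found = unit-window-avoiding (exceptions R) (factors-containing-b {x = x} {y = y} y=Πu w≡ often)
  j = proj₁ found
  b∈uj = proj₁ (proj₂ found)

  pump : ∀ z → at u j ≡ z → b ∈ z → Meets-aᴮbω (InEFω e f)
  pump (c ∷ zs) uj≡ b∈ =
    let n , bounded , blocks = aⁿb-decomposition _ v (letter-within-period b∈ x) in
    n , v , bounded , blocks , x , wseq ∞ (periodic (at u) j 0) , cycle c zs , x∈e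
      , repeat R j 0 (proj₂ (proj₂ found)) , refl , IsOmega-constant constant , λ _ → refl
    where
    v = x ++ω cycle c zs
    constant : ∀ i → periodic (at u) j 0 i ≡ c ∷ zs
    constant i = trans (cong (at u) (trans (cong (j +_) (n%1≡0 i)) (+-identityʳ j))) uj≡

lemma2p9 : (E : ωBExp AB) (w : ωWord AB) → ⟦ E ⟧ω w → InfinitelyMany b w →
    ∃[ n ] ∃[ v ] (Bounded n × IsOmega (aⁿb-blocks n) v × ⟦ E ⟧ω v)
lemma2p9 ((e , f) ∷ _) w (here w∈)  often = Meets-aᴮbω-mono here (summand e f w w∈ often)
lemma2p9 (_ ∷ E)       w (there w∈) often = Meets-aᴮbω-mono there (lemma2p9 E w w∈ often)
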